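{- Let $n\in\mathbb{N}$. The average of the coefficients of $p_n$, i.e. $\frac{1}{|\mathcal{A}_n|}\sum_{a\in\mathcal{A}_n}c_a$, equals $\frac{n!}{C_n}$, where $C_n=\frac{1}{n+1}\binom{2n}{n}$ is the $n$th Catalan number.
   Context: For $n\in\mathbb{N}$ and indeterminates $x_1,\ldots,x_n$, let $p_n=x_1(x_1+x_2)\cdots(x_1+x_2+\cdots+x_n)$. Let $\mathbb{N}_0=\mathbb{N}\cup\{0\}$ and $\mathcal{A}_n=\{(a_1,\ldots,a_n)\in\mathbb{N}_0^n : \sum_{i=k+1}^n a_i\le n-k \text{ for all } 1\le k\le n-1,\ \sum_{i=1}^n a_i=n\}$; these are exactly the exponent vectors of the distinct monomials of $p_n$. For $a\in\mathcal{A}_n$, $c_a$ denotes the coefficient of $x_1^{a_1}\cdots x_n^{a_n}$ in the expansion of $p_n$ (after combining like terms). -}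

module Defs where

open import Data.Nat using (ℕ; zero; suc; _+_; _*_; _∸_; _≤_; _≤?_; _/_)
open import Data.Nat.Properties using (_≟_)
open import Data.Nat.Combinatorics using (_C_)
open import Data.Fin using (Fin; toℕ)
open import Data.Fin.Properties using ()
open import Data.Product using (_×_; _,_)
open import Data.Nat.ListAction using (sum)
open import Data.List using (List; []; _∷_; map; filter; length; upTo; drop; concatMap; allFin; foldr; _++_)
open import Data.List.Relation.Unary.All using (All; all?)
open import Data.Vec as V using (Vec; toList; tabulate; zipWith; replicate)
import Data.Vec.Properties as VecP
open import Relation.Nullary using (Dec; yes; no)
open import Relation.Nullary.Decidable using (_×-dec_; ⌊_⌋)
open import Data.Bool using (if_then_else_)

-- Polynomials in n variables with ℕ coefficients, as formal sums of
-- terms (coefficient , exponent vector). Like terms are NOT combined in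
-- the representation; 'coeff' combines them.

Mono : ℕ → Set
Mono n = Vec ℕ n

Poly : ℕ → Set
Poly n = List (ℕ × Mono n)

one : ∀ {n} → Poly n
one = (1 , replicate _ 0) ∷ []

-- the variable x_{i+1}  (i : Fin n is 0-based)
var : ∀ {n} → Fin n → Poly n
var i = (1 , tabulate (λ j → if ⌊ toℕ j ≟ toℕ i ⌋ then 1 else 0)) ∷ []

_⊕_ : ∀ {n} → Poly n → Poly n → Poly n
p ⊕ q = p ++ q

_⊗_ : ∀ {n} → Poly n → Poly n → Poly n
p ⊗ q = concatMap (λ { (c , e) → map (λ { (d , f) → (c * d , zipWith _+_ e f) }) q }) p

-- x_1 + x_2 + ... + x_k  (the variables with 0-based index < k)
linSum : ∀ {n} → ℕ → Poly n
linSum {n} k = concatMap (λ i → if ⌊ suc (toℕ i) ≤? k ⌋ then var i else []) (allFin n)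

-- p_n = x_1 (x_1+x_2) ... (x_1+...+x_n)
p : (n : ℕ) → Poly n
p n = foldr (λ k acc → linSum k ⊗ acc) one (map suc (upTo n))

coeff : ∀ {n} → Poly n → Mono n → ℕ
coeff q a = sum (map (λ { (c , e) → if ⌊ VecP.≡-dec _≟_ e a ⌋ then c else 0 }) q)

c : (n : ℕ) → Mono n → ℕ
c n a = coeff (p n) a

-- Σ_{i=k+1}^n a_i ≤ n - k   for all 1 ≤ k ≤ n-1,  and  Σ_i a_i = n
InA : (n : ℕ) → Mono n → Set
InA n a = All (λ k → sum (drop k (toList a)) ≤ n ∸ k) (map suc (upTo (n ∸ 1)))
        × sum (toList a) ≡ n
  where open import Relation.Binary.PropositionalEquality using (_≡_)

InA? : (n : ℕ) → (a : Mono n) → Dec (InA n a)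
InA? n a = all? (λ k → sum (drop k (toList a)) ≤? n ∸ k) (map suc (upTo (n ∸ 1)))
           ×-dec (sum (toList a) ≟ n)

allVecs : (b m : ℕ) → List (Vec ℕ m)
allVecs b zero = V.[] ∷ []
allVecs b (suc m) = concatMap (λ x → map (x V.∷_) (allVecs b m)) (upTo (suc b))

-- 𝒜_n enumerated: every element of 𝒜_n has entries ≤ n (since they sum to n)
𝒜 : (n : ℕ) → List (Mono n)
𝒜 n = filter (InA? n) (allVecs n n)

open import Data.Nat using (_!) public

Catalan : ℕ → ℕ
Catalan n = ((2 * n) C n) / suc n

-- Every monomial of p_n has its exponent vector in 𝒜_n, so the coefficients over 𝒜_n add up
-- to p_n(1,…,1) = 1 · 2 ⋯ n = n!.  On the other side, a vector lies in 𝒜_n iff its entries sum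
-- to n and its last j entries sum to at most j for every j.  Splitting off the first entry
-- shows that these vectors are counted by ballot numbers, and the reflection principle
-- C(2n,n) − C(2n,n−1) = C(2n,n)/(n+1) identifies |𝒜_n| with the Catalan number C_n.
module Submission where

open import Level using (Level)
open import Function using (_∘_; mk⇔)
open import Data.Bool using (if_then_else_)
open import Data.Bool.Properties using (if-float)
open import Data.Unit using (⊤; tt)
open import Data.Product using (_×_; _,_; proj₁; proj₂)
open import Data.Sum using (inj₁; inj₂)
open import Data.Nat
open import Data.Nat.Properties
open import Data.Nat.Combinatorics using (_C_; nC1≡n; nCk≡nC[n∸k]; nCk+nC[k+1]≡[n+1]C[k+1])
open import Data.Nat.DivMod using (m*n/n≡m)
open import Data.Nat.ListAction using (sum; product)
open import Data.Nat.ListAction.Properties using (sum-++; product-++)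
open import Data.Nat.Tactic.RingSolver using (solve-∀)
open import Algebra.Properties.CommutativeSemigroup +-commutativeSemigroup using (interchange)
open import Data.Fin as Fin using (Fin; toℕ)
open import Data.List using (List; []; _∷_; _++_; [_]; map; upTo; applyUpTo; length; filter; concatMap; drop; allFin; foldr; tabulate)
open import Data.List.Properties using (map-++; map-upTo; map-applyUpTo; upTo-∷ʳ; map-cong; map-cong-local; length-++; length-map; length-upTo; map-tabulate; filter-++; filter-≐; filter-none; filter-accept; filter-reject)
open import Data.List.Membership.Propositional using (_∈_)
open import Data.List.Membership.Propositional.Properties using (∈-map⁺; ∈-upTo⁺)
open import Data.List.Relation.Unary.Any using (here; there)
open import Data.List.Relation.Unary.All as All using (All; []; _∷_)
open import Data.List.Relation.Unary.All.Properties using (all-upTo; map⁺; ++⁺; concat⁺)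
open import Data.List.Relation.Unary.AllPairs using (_∷_)
open import Data.List.Relation.Unary.Unique.Propositional using (Unique)
open import Data.List.Relation.Unary.Unique.Propositional.Properties using (upTo⁺)
open import Data.Vec as V using (Vec; toList)
open import Data.Vec.Properties using (∷-injectiveˡ; ∷-injectiveʳ; tabulate-cong)
import Data.Vec.Properties as VecP
import Data.Vec.Relation.Unary.All as VAll
open import Relation.Unary using (Pred; Decidable; _≐_)
open import Relation.Binary using (DecidableEquality)
open import Relation.Nullary using (¬_; yes; no; contradiction)
open import Relation.Nullary.Decidable using (⌊_⌋; _×-dec_; does-⇔; isYes≗does)
open import Relation.Binary.PropositionalEquality using (_≡_; refl; sym; trans; cong; cong₂; subst; subst₂; module ≡-Reasoning)

open import Defs

open ≡-Reasoning

private variable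
  ℓ : Level
  A B : Set

sum-upTo-suc : ∀ (f : ℕ → ℕ) N → sum (map f (upTo (suc N))) ≡ f 0 + sum (map (f ∘ suc) (upTo N))
sum-upTo-suc f N = cong (λ xs → f 0 + sum xs) (trans (map-applyUpTo suc f N) (sym (map-upTo (f ∘ suc) N)))

sum-upTo-∷ʳ : ∀ (f : ℕ → ℕ) N → sum (map f (upTo (suc N))) ≡ sum (map f (upTo N)) + f N
sum-upTo-∷ʳ f N = begin
  sum (map f (upTo (suc N)))        ≡⟨ cong (sum ∘ map f) (upTo-∷ʳ N) ⟨
  sum (map f (upTo N ++ [ N ]))     ≡⟨ cong sum (map-++ f (upTo N) [ N ]) ⟩
  sum (map f (upTo N) ++ [ f N ])   ≡⟨ sum-++ (map f (upTo N)) [ f N ] ⟩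
  sum (map f (upTo N)) + (f N + 0)  ≡⟨ cong (sum (map f (upTo N)) +_) (+-identityʳ (f N)) ⟩
  sum (map f (upTo N)) + f N        ∎

sum-upTo-vanishing : ∀ (f : ℕ → ℕ) {M} → (∀ {x} → M ≤ x → f x ≡ 0) →
                     ∀ {N} → M ≤ N → sum (map f (upTo N)) ≡ sum (map f (upTo M))
sum-upTo-vanishing f vanish {N = N} M≤N with m≤n⇒m<n∨m≡n M≤N
... | inj₂ refl = refl
sum-upTo-vanishing f {M} vanish {suc N} _ | inj₁ (s≤s M≤N) = begin
  sum (map f (upTo (suc N)))  ≡⟨ sum-upTo-∷ʳ f N ⟩
  sum (map f (upTo N)) + f N  ≡⟨ cong₂ _+_ (sum-upTo-vanishing f vanish M≤N) (vanish M≤N) ⟩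
  sum (map f (upTo M)) + 0    ≡⟨ +-identityʳ _ ⟩
  sum (map f (upTo M))        ∎

map-suc-upTo-∷ʳ : ∀ n → map suc (upTo (suc n)) ≡ map suc (upTo n) ++ [ suc n ]
map-suc-upTo-∷ʳ n = trans (cong (map suc) (sym (upTo-∷ʳ n))) (map-++ suc (upTo n) [ n ])

factorial-upTo : ∀ n → product (map suc (upTo n)) ≡ n !
factorial-upTo zero    = refl
factorial-upTo (suc n) = begin
  product (map suc (upTo (suc n)))         ≡⟨ cong product (map-suc-upTo-∷ʳ n) ⟩
  product (map suc (upTo n) ++ [ suc n ])  ≡⟨ product-++ (map suc (upTo n)) [ suc n ] ⟩
  product (map suc (upTo n)) * (suc n * 1) ≡⟨ cong₂ _*_ (factorial-upTo n) (*-identityʳ (suc n)) ⟩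
  n ! * suc n                              ≡⟨ *-comm (n !) (suc n) ⟩
  suc n !                                  ∎

sum-map-const : ∀ (k : ℕ) (xs : List A) → sum (map (λ _ → k) xs) ≡ length xs * k
sum-map-const k []       = refl
sum-map-const k (x ∷ xs) = cong (k +_) (sum-map-const k xs)

sum-map-+ : ∀ (f g : A → ℕ) xs → sum (map (λ x → f x + g x) xs) ≡ sum (map f xs) + sum (map g xs)
sum-map-+ f g []       = refl
sum-map-+ f g (x ∷ xs) = trans (cong (f x + g x +_) (sum-map-+ f g xs)) (interchange (f x) (g x) _ _)

sum-map-if-≟ : ∀ (_≟_ : DecidableEquality A) x (k : ℕ) ys →
               sum (map (λ y → if ⌊ x ≟ y ⌋ then k else 0) ys) ≡ length (filter (x ≟_) ys) * k
sum-map-if-≟ _≟_ x k []       = refl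
sum-map-if-≟ _≟_ x k (y ∷ ys) with x ≟ y
... | yes _ = cong (k +_) (sum-map-if-≟ _≟_ x k ys)
... | no  _ = sum-map-if-≟ _≟_ x k ys

length-filter-map : ∀ {P : Pred B ℓ} (P? : Decidable P) (f : A → B) xs →
                    length (filter P? (map f xs)) ≡ length (filter (P? ∘ f) xs)
length-filter-map P? f []       = refl
length-filter-map P? f (x ∷ xs) with P? (f x)
... | yes _ = cong suc (length-filter-map P? f xs)
... | no  _ = length-filter-map P? f xs

length-filter-concatMap : ∀ {P : Pred B ℓ} (P? : Decidable P) (f : A → List B) xs →
                          length (filter P? (concatMap f xs)) ≡ sum (map (length ∘ filter P? ∘ f) xs)
length-filter-concatMap P? f []       = refl
length-filter-concatMap P? f (x ∷ xs) = begin
  length (filter P? (f x ++ concatMap f xs))                 ≡⟨ cong length (filter-++ P? (f x) (concatMap f xs)) ⟩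
  length (filter P? (f x) ++ filter P? (concatMap f xs))     ≡⟨ length-++ (filter P? (f x)) ⟩
  length (filter P? (f x)) + length (filter P? (concatMap f xs))
    ≡⟨ cong (length (filter P? (f x)) +_) (length-filter-concatMap P? f xs) ⟩
  length (filter P? (f x)) + sum (map (length ∘ filter P? ∘ f) xs) ∎

length-filter-≟-unique : ∀ (_≟_ : DecidableEquality A) {x xs} → Unique xs → x ∈ xs → length (filter (x ≟_) xs) ≡ 1
length-filter-≟-unique _≟_ (x∉xs ∷ _) (here refl) =
  trans (cong length (filter-accept (_ ≟_) refl)) (cong (suc ∘ length) (filter-none (_ ≟_) x∉xs))
length-filter-≟-unique _≟_ (y∉ys ∷ unique) (there x∈ys) =
  trans (cong length (filter-reject (_ ≟_) (All.lookup y∉ys x∈ys ∘ sym))) (length-filter-≟-unique _≟_ unique x∈ys)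

filter-filter-⊆ : ∀ {P Q : Pred A ℓ} (P? : Decidable P) (Q? : Decidable Q) → (∀ {x} → P x → Q x) →
                  ∀ xs → filter P? (filter Q? xs) ≡ filter P? xs
filter-filter-⊆ P? Q? P⊆Q []       = refl
filter-filter-⊆ P? Q? P⊆Q (x ∷ xs) with P? x
... | yes px = begin
  filter P? (filter Q? (x ∷ xs))  ≡⟨ cong (filter P?) (filter-accept Q? (P⊆Q px)) ⟩
  filter P? (x ∷ filter Q? xs)    ≡⟨ filter-accept P? px ⟩
  x ∷ filter P? (filter Q? xs)    ≡⟨ cong (x ∷_) (filter-filter-⊆ P? Q? P⊆Q xs) ⟩
  x ∷ filter P? xs                ∎
... | no ¬px with Q? x
...   | yes _ = trans (filter-reject P? ¬px) (filter-filter-⊆ P? Q? P⊆Q xs)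
...   | no  _ = filter-filter-⊆ P? Q? P⊆Q xs

tabulate-∘toℕ : ∀ n (f : ℕ → A) → tabulate {n = n} (f ∘ toℕ) ≡ applyUpTo f n
tabulate-∘toℕ zero    f = refl
tabulate-∘toℕ (suc n) f = cong (f 0 ∷_) (tabulate-∘toℕ n (f ∘ suc))

map-∘toℕ-allFin : ∀ n (f : ℕ → A) → map (f ∘ toℕ) (allFin n) ≡ map f (upTo n)
map-∘toℕ-allFin n f = trans (map-tabulate (λ i → i) (f ∘ toℕ)) (trans (tabulate-∘toℕ n f) (sym (map-upTo f n)))

pascal : ∀ n k → suc n C suc k ≡ n C k + n C suc k
pascal n k = sym (nCk+nC[k+1]≡[n+1]C[k+1] n k)

[k+1]*nC[k+1]+k*nCk≡n*nCk : ∀ n k → suc k * (n C suc k) + k * (n C k) ≡ n * (n C k)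
[k+1]*nC[k+1]+k*nCk≡n*nCk zero    zero    = refl
[k+1]*nC[k+1]+k*nCk≡n*nCk zero    (suc k) = cong₂ _+_ (*-zeroʳ (2 + k)) (*-zeroʳ (suc k))
[k+1]*nC[k+1]+k*nCk≡n*nCk (suc n) zero    =
  trans (+-identityʳ _) (trans (+-identityʳ _) (trans (nC1≡n (suc n)) (sym (*-identityʳ (suc n)))))
[k+1]*nC[k+1]+k*nCk≡n*nCk (suc n) (suc k) = begin
    (2 + k) * (suc n C (2 + k)) + suc k * (suc n C suc k)
  ≡⟨ cong₂ (λ x y → (2 + k) * x + suc k * y) (pascal n (suc k)) (pascal n k) ⟩
    (2 + k) * (a + b) + suc k * (d + a)
  ≡⟨ regroup k a b d ⟩
    ((2 + k) * b + suc k * a) + (suc k * a + k * d) + (a + d)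
  ≡⟨ cong₂ (λ x y → x + y + (a + d)) ([k+1]*nC[k+1]+k*nCk≡n*nCk n (suc k)) ([k+1]*nC[k+1]+k*nCk≡n*nCk n k) ⟩
    n * a + n * d + (a + d)
  ≡⟨ collect n a d ⟩
    suc n * (d + a)
  ≡⟨ cong (suc n *_) (pascal n k) ⟨
    suc n * (suc n C suc k)
  ∎
  where
  a = n C suc k
  b = n C (2 + k)
  d = n C k
  regroup : ∀ k a b d → (2 + k) * (a + b) + suc k * (d + a) ≡ ((2 + k) * b + suc k * a) + (suc k * a + k * d) + (a + d)
  regroup = solve-∀
  collect : ∀ n a d → n * a + n * d + (a + d) ≡ suc n * (d + a)
  collect = solve-∀

[m+[1+m]]Cm≡[m+[1+m]]C[1+m] : ∀ m → (m + suc m) C m ≡ (m + suc m) C suc m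
[m+[1+m]]Cm≡[m+[1+m]]C[1+m] m = begin
  (m + suc m) C m                    ≡⟨ cong ((m + suc m) C_) (m+n∸n≡m m (suc m)) ⟨
  (m + suc m) C (m + suc m ∸ suc m)  ≡⟨ nCk≡nC[n∸k] (m≤n+m (suc m) m) ⟨
  (m + suc m) C suc m                ∎

-- ballot m s counts the vectors in ℕ^m with entry sum s whose last j entries sum to at most j
-- for every j (length-filter-isBallot); the recursion chooses the first entry x.
ballot : ℕ → ℕ → ℕ
ballot zero    zero    = 1
ballot zero    (suc s) = 0
ballot (suc m) s       = if ⌊ s ≤? suc m ⌋ then sum (map (λ x → ballot m (s ∸ x)) (upTo (suc s))) else 0

ballot-suc : ∀ {m s} → s ≤ suc m → ballot (suc m) s ≡ sum (map (λ x → ballot m (s ∸ x)) (upTo (suc s)))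
ballot-suc {m} {s} s≤1+m with s ≤? suc m
... | yes _   = refl
... | no  s≰ = contradiction s≤1+m s≰

ballot-> : ∀ {m s} → m < s → ballot m s ≡ 0
ballot-> {zero}  {suc s} _   = refl
ballot-> {suc m} {s}     m<s with s ≤? suc m
... | yes s≤ = contradiction s≤ (<⇒≱ m<s)
... | no  _  = refl

ballot-zero : ∀ m → ballot m 0 ≡ 1
ballot-zero zero    = refl
ballot-zero (suc m) = trans (ballot-suc {m} z≤n) (trans (+-identityʳ _) (ballot-zero m))

ballot-pascal : ∀ {m s} → s < suc m → ballot (suc m) (suc s) ≡ ballot m (suc s) + ballot (suc m) s
ballot-pascal {m} {s} s<1+m = begin
    ballot (suc m) (suc s)
  ≡⟨ ballot-suc s<1+m ⟩
    sum (map (λ x → ballot m (suc s ∸ x)) (upTo (2 + s)))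
  ≡⟨ sum-upTo-suc (λ x → ballot m (suc s ∸ x)) (suc s) ⟩
    ballot m (suc s) + sum (map (λ x → ballot m (s ∸ x)) (upTo (suc s)))
  ≡⟨ cong (ballot m (suc s) +_) (ballot-suc (<⇒≤ s<1+m)) ⟨
    ballot m (suc s) + ballot (suc m) s
  ∎

-- Reflection principle: ballot m (s+1) = C(m+s+1, s+1) − C(m+s+1, s).
ballot+C≡C : ∀ m s → s ≤ m → ballot m (suc s) + (m + suc s) C s ≡ (m + suc s) C suc s
ballot+C≡C zero    zero    _ = refl
ballot+C≡C (suc m) zero    _ = begin
  ballot (suc m) 1 + 1            ≡⟨ cong (_+ 1) (ballot-pascal {m} (s≤s z≤n)) ⟩
  ballot m 1 + ballot (suc m) 0 + 1  ≡⟨ cong (λ x → ballot m 1 + x + 1) (ballot-zero (suc m)) ⟩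
  ballot m 1 + 1 + 1              ≡⟨ cong (_+ 1) (ballot+C≡C m 0 z≤n) ⟩
  (m + 1) C 1 + 1                 ≡⟨ +-comm ((m + 1) C 1) 1 ⟩
  (m + 1) C 0 + (m + 1) C 1       ≡⟨ pascal (m + 1) 0 ⟨
  (suc m + 1) C 1                 ∎
ballot+C≡C (suc m) (suc s) (s≤s s≤m) with m≤n⇒m<n∨m≡n s≤m
... | inj₂ refl = cong₂ _+_ (ballot-> (n<1+n (suc m))) ([m+[1+m]]Cm≡[m+[1+m]]C[1+m] (suc m))
... | inj₁ s<m = begin
    ballot (suc m) (2 + s) + suc N C suc s
  ≡⟨ cong₂ _+_ (ballot-pascal {m} (s≤s s<m)) (pascal N s) ⟩
    (ballot m (2 + s) + ballot (suc m) (suc s)) + (N C s + N C suc s)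
  ≡⟨ regroup (ballot m (2 + s)) (ballot (suc m) (suc s)) (N C s) (N C suc s) ⟩
    (ballot (suc m) (suc s) + N C s) + (ballot m (2 + s) + N C suc s)
  ≡⟨ cong₂ _+_ ih (ballot+C≡C m (suc s) s<m) ⟩
    N C suc s + N C (2 + s)
  ≡⟨ pascal N (suc s) ⟨
    suc N C (2 + s)
  ∎
  where
  N = m + suc (suc s)
  ih : ballot (suc m) (suc s) + N C s ≡ N C suc s
  ih = subst (λ M → ballot (suc m) (suc s) + M C s ≡ M C suc s) (sym (+-suc m (suc s)))
             (ballot+C≡C (suc m) s (m≤n⇒m≤1+n (<⇒≤ s<m)))
  regroup : ∀ a b c d → (a + b) + (c + d) ≡ (b + c) + (a + d)
  regroup = solve-∀

[n+n]Cn≡[1+n]*ballot : ∀ n → (n + n) C n ≡ suc n * ballot n n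
[n+n]Cn≡[1+n]*ballot zero    = refl
[n+n]Cn≡[1+n]*ballot (suc k) = begin
  Y          ≡⟨ G+X≡Y ⟨
  G + X      ≡⟨ cong (G +_) nG≡X ⟨
  suc n * G  ∎
  where
  n = suc k
  G = ballot n n
  X = (n + n) C k
  Y = (n + n) C n
  G+X≡Y : G + X ≡ Y
  G+X≡Y = ballot+C≡C n k (n≤1+n k)
  nY≡[1+n]X : n * Y ≡ suc n * X
  nY≡[1+n]X = +-cancelʳ-≡ (k * X) _ _ (begin
    n * Y + k * X        ≡⟨ [k+1]*nC[k+1]+k*nCk≡n*nCk (n + n) k ⟩
    (n + n) * X          ≡⟨ split k X ⟩
    suc n * X + k * X    ∎)
    where
    split : ∀ k X → (suc k + suc k) * X ≡ (2 + k) * X + k * X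
    split = solve-∀
  nG≡X : n * G ≡ X
  nG≡X = +-cancelʳ-≡ (n * X) _ _ (begin
    n * G + n * X  ≡⟨ *-distribˡ-+ n G X ⟨
    n * (G + X)    ≡⟨ cong (n *_) G+X≡Y ⟩
    n * Y          ≡⟨ nY≡[1+n]X ⟩
    X + n * X      ∎)

Catalan≡ballot : ∀ n → Catalan n ≡ ballot n n
Catalan≡ballot n = begin
  ((2 * n) C n) / suc n             ≡⟨ cong (λ m → (m C n) / suc n) (cong (n +_) (+-identityʳ n)) ⟩
  ((n + n) C n) / suc n             ≡⟨ cong (_/ suc n) ([n+n]Cn≡[1+n]*ballot n) ⟩
  (suc n * ballot n n) / suc n      ≡⟨ cong (_/ suc n) (*-comm (suc n) (ballot n n)) ⟩
  (ballot n n * suc n) / suc n      ≡⟨ m*n/n≡m (ballot n n) (suc n) ⟩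
  ballot n n                       ∎

vsum : ∀ {m} → Vec ℕ m → ℕ
vsum v = sum (toList v)

sumFrom : ∀ {m} → ℕ → Vec ℕ m → ℕ
sumFrom k v = sum (drop k (toList v))

sumFrom≤vsum : ∀ {m} t (v : Vec ℕ m) → sumFrom t v ≤ vsum v
sumFrom≤vsum zero    v           = ≤-refl
sumFrom≤vsum (suc t) V.[]        = z≤n
sumFrom≤vsum (suc t) (x V.∷ v)   = m≤n⇒m≤o+n x (sumFrom≤vsum t v)

sumFrom-zipWith : ∀ {m} t (e f : Vec ℕ m) → sumFrom t (V.zipWith _+_ e f) ≡ sumFrom t e + sumFrom t f
sumFrom-zipWith zero    V.[]        V.[]        = refl
sumFrom-zipWith (suc t) V.[]        V.[]        = refl
sumFrom-zipWith zero    (x V.∷ e) (y V.∷ f) = trans (cong (x + y +_) (sumFrom-zipWith zero e f)) (interchange x y (vsum e) (vsum f))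
sumFrom-zipWith (suc t) (x V.∷ e) (y V.∷ f) = sumFrom-zipWith t e f

vsum≤⇒All≤ : ∀ {m b} (v : Vec ℕ m) → vsum v ≤ b → VAll.All (_≤ b) v
vsum≤⇒All≤ V.[]      _     = VAll.[]
vsum≤⇒All≤ (x V.∷ v) sum≤b = m+n≤o⇒m≤o x sum≤b VAll.∷ vsum≤⇒All≤ v (m+n≤o⇒n≤o x sum≤b)

vsum-replicate-0 : ∀ n → vsum (V.replicate n 0) ≡ 0
vsum-replicate-0 zero    = refl
vsum-replicate-0 (suc n) = vsum-replicate-0 n

vsum-tabulate-0 : ∀ n → vsum (V.tabulate {n = n} (λ _ → 0)) ≡ 0
vsum-tabulate-0 zero    = refl
vsum-tabulate-0 (suc n) = vsum-tabulate-0 n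

⌊suc≟suc⌋ : ∀ a b → ⌊ suc a ≟ suc b ⌋ ≡ ⌊ a ≟ b ⌋
⌊suc≟suc⌋ a b = trans (isYes≗does (suc a ≟ suc b))
  (trans (does-⇔ (mk⇔ suc-injective (cong suc)) (suc a ≟ suc b) (a ≟ b)) (sym (isYes≗does (a ≟ b))))

unit : ∀ {n} → Fin n → Mono n
unit i = V.tabulate (λ j → if ⌊ toℕ j ≟ toℕ i ⌋ then 1 else 0)

unit-suc : ∀ {n} (i : Fin n) → unit (Fin.suc i) ≡ 0 V.∷ unit i
unit-suc i = cong (0 V.∷_) (tabulate-cong (λ j → cong (if_then 1 else 0) (⌊suc≟suc⌋ (toℕ j) (toℕ i))))

vsum-unit : ∀ {n} (i : Fin n) → vsum (unit i) ≡ 1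
vsum-unit {suc n} Fin.zero    = cong suc (vsum-tabulate-0 n)
vsum-unit         (Fin.suc i) = trans (cong vsum (unit-suc i)) (vsum-unit i)

sumFrom-unit : ∀ {n t} (i : Fin n) → toℕ i < t → sumFrom t (unit i) ≡ 0
sumFrom-unit {suc n} {suc t} Fin.zero    _ =
  n≤0⇒n≡0 (subst (sumFrom t (V.tabulate {n = n} (λ _ → 0)) ≤_) (vsum-tabulate-0 n) (sumFrom≤vsum t _))
sumFrom-unit {suc n} {suc t} (Fin.suc i) (s≤s i<t) = trans (cong (sumFrom (suc t)) (unit-suc i)) (sumFrom-unit i i<t)

_≟ᵥ_ : ∀ {m} → DecidableEquality (Vec ℕ m)
_≟ᵥ_ = VecP.≡-dec _≟_

length-filter-allVecs : ∀ {m} {P : Pred (Vec ℕ (suc m)) ℓ} (P? : Decidable P) b →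
                        length (filter P? (allVecs b (suc m))) ≡
                        sum (map (λ x → length (filter (P? ∘ (x V.∷_)) (allVecs b m))) (upTo (suc b)))
length-filter-allVecs {m = m} P? b = trans (length-filter-concatMap P? (λ x → map (x V.∷_) (allVecs b m)) (upTo (suc b)))
  (cong sum (map-cong (λ x → length-filter-map P? (x V.∷_) (allVecs b m)) (upTo (suc b))))

length-filter-≟-allVecs : ∀ {b m} {e : Vec ℕ m} → VAll.All (_≤ b) e → length (filter (e ≟ᵥ_) (allVecs b m)) ≡ 1
length-filter-≟-allVecs {b} {zero}  {V.[]}     VAll.[]              = refl
length-filter-≟-allVecs {b} {suc m} {x V.∷ e} (x≤b VAll.∷ e≤b) = begin
    length (filter ((x V.∷ e) ≟ᵥ_) (allVecs b (suc m)))
  ≡⟨ length-filter-allVecs {m = m} ((x V.∷ e) ≟ᵥ_) b ⟩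
    sum (map count (upTo (suc b)))
  ≡⟨ cong sum (map-cong count≡indicator (upTo (suc b))) ⟩
    sum (map (λ y → if ⌊ x ≟ y ⌋ then 1 else 0) (upTo (suc b)))
  ≡⟨ sum-map-if-≟ _≟_ x 1 (upTo (suc b)) ⟩
    length (filter (x ≟_) (upTo (suc b))) * 1
  ≡⟨ cong (_* 1) (length-filter-≟-unique _≟_ (upTo⁺ (suc b)) (∈-upTo⁺ (s≤s x≤b))) ⟩
    1
  ∎
  where
  count : ℕ → ℕ
  count y = length (filter (((x V.∷ e) ≟ᵥ_) ∘ (y V.∷_)) (allVecs b m))
  count≡indicator : ∀ y → count y ≡ (if ⌊ x ≟ y ⌋ then 1 else 0)
  count≡indicator y with x ≟ y
  ... | yes refl = trans (cong length (filter-≐ _ (e ≟ᵥ_) (∷-injectiveʳ , cong (x V.∷_)) (allVecs b m)))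
                         (length-filter-≟-allVecs e≤b)
  ... | no  x≢y = cong length (filter-none _ (All.universal (λ _ → x≢y ∘ ∷-injectiveˡ) (allVecs b m)))

-- The size of 𝒜_n
SuffixBounded : ∀ {m} → Vec ℕ m → Set
SuffixBounded V.[]              = ⊤
SuffixBounded {suc m} (x V.∷ v) = x + vsum v ≤ suc m × SuffixBounded v

suffixBounded? : ∀ {m} → Decidable (SuffixBounded {m})
suffixBounded? V.[]              = yes tt
suffixBounded? {suc m} (x V.∷ v) = (x + vsum v ≤? suc m) ×-dec suffixBounded? v

IsBallot : ∀ {m} → ℕ → Vec ℕ m → Set
IsBallot s v = SuffixBounded v × vsum v ≡ s

isBallot? : ∀ {m} s → Decidable (IsBallot {m} s)
isBallot? s v = suffixBounded? v ×-dec (vsum v ≟ s)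

IsBallot-∷⇒≤ : ∀ {m s x} {v : Vec ℕ m} → IsBallot s (x V.∷ v) → x ≤ s
IsBallot-∷⇒≤ {x = x} {v} (_ , sum≡s) = subst (x ≤_) sum≡s (m≤m+n x (vsum v))

IsBallot-∷⇒≤length : ∀ {m s x} {v : Vec ℕ m} → IsBallot s (x V.∷ v) → s ≤ suc m
IsBallot-∷⇒≤length ((bound , _) , sum≡s) = subst (_≤ _) sum≡s bound

IsBallot-∷≐ : ∀ {m s x} → x ≤ s → s ≤ suc m → (IsBallot s ∘ (x V.∷_)) ≐ IsBallot {m} (s ∸ x)
IsBallot-∷≐ {m} {s} {x} x≤s s≤1+m = drop-head , add-head
  where
  drop-head : ∀ {v} → IsBallot s (x V.∷ v) → IsBallot (s ∸ x) v
  drop-head {v} ((_ , sb) , sum≡s) = sb , trans (sym (m+n∸m≡n x (vsum v))) (cong (_∸ x) sum≡s)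
  add-head : ∀ {v} → IsBallot (s ∸ x) v → IsBallot s (x V.∷ v)
  add-head {v} (sb , sum≡s∸x) = (subst (_≤ suc m) (sym sum≡s) s≤1+m , sb) , sum≡s
    where
    sum≡s : x + vsum v ≡ s
    sum≡s = trans (cong (x +_) sum≡s∸x) (m+[n∸m]≡n x≤s)

length-filter-isBallot : ∀ {b} m s → m ≤ b → length (filter (isBallot? s) (allVecs b m)) ≡ ballot m s
length-filter-isBallot zero    zero    _   = refl
length-filter-isBallot zero    (suc s) _   = refl
length-filter-isBallot {b} (suc m) s 1+m≤b = trans (length-filter-allVecs {m = m} (isBallot? s) b) sum-count
  where
  count : ℕ → ℕ
  count x = length (filter (isBallot? s ∘ (x V.∷_)) (allVecs b m))
  count-vanishes : ∀ {x} → (∀ {v} → ¬ IsBallot s (x V.∷ v)) → count x ≡ 0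
  count-vanishes {x} none = cong length (filter-none (isBallot? s ∘ (x V.∷_)) (All.universal (λ _ → none) (allVecs b m)))
  count≡ballot : s ≤ suc m → ∀ {x} → x < suc s → count x ≡ ballot m (s ∸ x)
  count≡ballot s≤1+m {x} (s≤s x≤s) =
    trans (cong length (filter-≐ (isBallot? s ∘ (x V.∷_)) (isBallot? (s ∸ x)) (IsBallot-∷≐ x≤s s≤1+m) (allVecs b m)))
          (length-filter-isBallot m (s ∸ x) (≤-trans (n≤1+n m) 1+m≤b))
  sum-count : sum (map count (upTo (suc b))) ≡ ballot (suc m) s
  sum-count with s ≤? suc m
  ... | no s≰1+m = sum-upTo-vanishing count {0} (λ _ → count-vanishes (s≰1+m ∘ IsBallot-∷⇒≤length)) {suc b} z≤n
  ... | yes s≤1+m = begin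
      sum (map count (upTo (suc b)))
    ≡⟨ sum-upTo-vanishing count (λ s<x → count-vanishes (<⇒≱ s<x ∘ IsBallot-∷⇒≤)) (s≤s (≤-trans s≤1+m 1+m≤b)) ⟩
      sum (map count (upTo (suc s)))
    ≡⟨ cong sum (map-cong-local (All.map (count≡ballot s≤1+m) (all-upTo (suc s)))) ⟩
      sum (map (λ x → ballot m (s ∸ x)) (upTo (suc s)))
    ∎

SuffixBounded⇒sumFrom≤ : ∀ {m} {v : Vec ℕ m} → SuffixBounded v → ∀ {k} → k < m → sumFrom k v ≤ m ∸ k
SuffixBounded⇒sumFrom≤ {v = x V.∷ w} (bound , _)  {zero}  _         = bound
SuffixBounded⇒sumFrom≤ {v = x V.∷ w} (_ , sb)     {suc k} (s≤s k<m) = SuffixBounded⇒sumFrom≤ sb k<m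

sumFrom≤⇒SuffixBounded : ∀ {m} {v : Vec ℕ m} → (∀ {k} → k < m → sumFrom k v ≤ m ∸ k) → SuffixBounded v
sumFrom≤⇒SuffixBounded {v = V.[]}    _     = tt
sumFrom≤⇒SuffixBounded {v = x V.∷ w} bound = bound z<s , sumFrom≤⇒SuffixBounded (bound ∘ s≤s)

InA-intro : ∀ {n} {a : Mono n} → (∀ {k} → k < n → sumFrom k a ≤ n ∸ k) → vsum a ≡ n → InA n a
InA-intro {n} bound sum≡n = map⁺ (All.map (bound ∘ suc<) (all-upTo (n ∸ 1))) , sum≡n
  where
  suc< : ∀ {k n} → k < n ∸ 1 → suc k < n
  suc< {n = suc n} k<n = s≤s k<n

InA⇒sumFrom≤ : ∀ {n} {a : Mono n} → InA n a → ∀ {k} → k < n → sumFrom k a ≤ n ∸ k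
InA⇒sumFrom≤ (_ , sum≡n) {zero}  _                 = ≤-reflexive sum≡n
InA⇒sumFrom≤ (bounds , _) {suc k} (s≤s {n = n} k<n) = All.lookup bounds (∈-map⁺ suc (∈-upTo⁺ k<n))

InA≐IsBallot : ∀ n → InA n ≐ IsBallot n
InA≐IsBallot n = (λ inA → sumFrom≤⇒SuffixBounded (InA⇒sumFrom≤ inA) , proj₂ inA)
               , (λ (sb , sum≡n) → InA-intro (SuffixBounded⇒sumFrom≤ sb) sum≡n)

length-𝒜 : ∀ n → length (𝒜 n) ≡ ballot n n
length-𝒜 n = trans (cong length (filter-≐ (InA? n) (isBallot? n) (InA≐IsBallot n) (allVecs n n)))
                   (length-filter-isBallot n n ≤-refl)

-- The coefficient sum over 𝒜_n
AllExponents : ∀ {n} → Pred (Mono n) ℓ → Poly n → Set ℓ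
AllExponents P q = All (P ∘ proj₂) q

totalCoeff : ∀ {n} → Poly n → ℕ
totalCoeff q = sum (map proj₁ q)

sum-coeff≡totalCoeff : ∀ {n} (q : Poly n) L → AllExponents (λ e → length (filter (e ≟ᵥ_) L) ≡ 1) q →
                       sum (map (coeff q) L) ≡ totalCoeff q
sum-coeff≡totalCoeff []            L []             = trans (sum-map-const 0 L) (*-zeroʳ (length L))
sum-coeff≡totalCoeff ((k , e) ∷ q) L (once ∷ onces) = begin
    sum (map (coeff ((k , e) ∷ q)) L)
  ≡⟨ sum-map-+ (λ a → if ⌊ e ≟ᵥ a ⌋ then k else 0) (coeff q) L ⟩
    sum (map (λ a → if ⌊ e ≟ᵥ a ⌋ then k else 0) L) + sum (map (coeff q) L)
  ≡⟨ cong₂ _+_ (sum-map-if-≟ _≟ᵥ_ e k L) (sum-coeff≡totalCoeff q L onces) ⟩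
    length (filter (e ≟ᵥ_) L) * k + totalCoeff q
  ≡⟨ cong (λ m → m * k + totalCoeff q) once ⟩
    1 * k + totalCoeff q
  ≡⟨ cong (_+ totalCoeff q) (*-identityˡ k) ⟩
    k + totalCoeff q
  ∎

length-filter-≟-𝒜 : ∀ {n} {e : Mono n} → InA n e → VAll.All (_≤ n) e → length (filter (e ≟ᵥ_) (𝒜 n)) ≡ 1
length-filter-≟-𝒜 {n} {e} inA e≤n =
  trans (cong length (filter-filter-⊆ (e ≟ᵥ_) (InA? n) (λ { refl → inA }) (allVecs n n))) (length-filter-≟-allVecs e≤n)

totalCoeff-++ : ∀ {n} (q r : Poly n) → totalCoeff (q ++ r) ≡ totalCoeff q + totalCoeff r
totalCoeff-++ q r = trans (cong sum (map-++ proj₁ q r)) (sum-++ (map proj₁ q) (map proj₁ r))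

totalCoeff-map : ∀ {n} k (g : ℕ × Mono n → ℕ × Mono n) → (∀ t → proj₁ (g t) ≡ k * proj₁ t) →
                 ∀ r → totalCoeff (map g r) ≡ k * totalCoeff r
totalCoeff-map k g scales []      = sym (*-zeroʳ k)
totalCoeff-map k g scales (t ∷ r) = begin
  proj₁ (g t) + totalCoeff (map g r)  ≡⟨ cong₂ _+_ (scales t) (totalCoeff-map k g scales r) ⟩
  k * proj₁ t + k * totalCoeff r      ≡⟨ *-distribˡ-+ k (proj₁ t) (totalCoeff r) ⟨
  k * totalCoeff (t ∷ r)              ∎

totalCoeff-map-++ : ∀ {n} k (g : ℕ × Mono n → ℕ × Mono n) → (∀ t → proj₁ (g t) ≡ k * proj₁ t) →
                    ∀ r z → totalCoeff (map g r ++ z) ≡ k * totalCoeff r + totalCoeff z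
totalCoeff-map-++ k g scales r z = trans (totalCoeff-++ (map g r) z) (cong (_+ totalCoeff z) (totalCoeff-map k g scales r))

totalCoeff-⊗ : ∀ {n} (q r : Poly n) → totalCoeff (q ⊗ r) ≡ totalCoeff q * totalCoeff r
totalCoeff-⊗ []            r = refl
totalCoeff-⊗ ((k , e) ∷ q) r = begin
  totalCoeff (((k , e) ∷ q) ⊗ r)
    ≡⟨ totalCoeff-map-++ k _ (λ _ → refl) r (q ⊗ r) ⟩
  k * totalCoeff r + totalCoeff (q ⊗ r)
    ≡⟨ cong (k * totalCoeff r +_) (totalCoeff-⊗ q r) ⟩
  k * totalCoeff r + totalCoeff q * totalCoeff r
    ≡⟨ *-distribʳ-+ (totalCoeff r) k (totalCoeff q) ⟨
  (k + totalCoeff q) * totalCoeff r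
    ∎

totalCoeff-concatMap : ∀ {n} (f : A → Poly n) xs → totalCoeff (concatMap f xs) ≡ sum (map (totalCoeff ∘ f) xs)
totalCoeff-concatMap f []       = refl
totalCoeff-concatMap f (x ∷ xs) =
  trans (totalCoeff-++ (f x) (concatMap f xs)) (cong (totalCoeff (f x) +_) (totalCoeff-concatMap f xs))

totalCoeff-linSum : ∀ {n k} → k ≤ n → totalCoeff (linSum {n} k) ≡ k
totalCoeff-linSum {n} {k} k≤n = begin
  totalCoeff (linSum {n} k)                ≡⟨ totalCoeff-concatMap _ (allFin n) ⟩
  sum (map (totalCoeff ∘ term) (allFin n)) ≡⟨ cong sum (map-cong (λ i → if-float totalCoeff ⌊ suc (toℕ i) ≤? k ⌋) (allFin n)) ⟩
  sum (map (below ∘ toℕ) (allFin n))       ≡⟨ cong sum (map-∘toℕ-allFin n below) ⟩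
  sum (map below (upTo n))                 ≡⟨ sum-upTo-vanishing below below-vanishes k≤n ⟩
  sum (map below (upTo k))                 ≡⟨ cong sum (map-cong-local (All.map below≡1 (all-upTo k))) ⟩
  sum (map (λ _ → 1) (upTo k))             ≡⟨ sum-map-const 1 (upTo k) ⟩
  length (upTo k) * 1                      ≡⟨ *-identityʳ _ ⟩
  length (upTo k)                          ≡⟨ length-upTo k ⟩
  k                                        ∎
  where
  term : Fin n → Poly n
  term i = if ⌊ suc (toℕ i) ≤? k ⌋ then var i else []
  below : ℕ → ℕ
  below j = if ⌊ suc j ≤? k ⌋ then 1 else 0
  below≡1 : ∀ {j} → j < k → below j ≡ 1
  below≡1 {j} j<k with suc j ≤? k
  ... | yes _   = refl
  ... | no  j≮k = contradiction j<k j≮k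
  below-vanishes : ∀ {j} → k ≤ j → below j ≡ 0
  below-vanishes {j} k≤j with suc j ≤? k
  ... | yes j<k = contradiction k≤j (<⇒≱ j<k)
  ... | no  _   = refl

∏linSum : ∀ {n} → List ℕ → Poly n
∏linSum = foldr (λ k acc → linSum k ⊗ acc) one

totalCoeff-∏linSum : ∀ {n} ks → All (_≤ n) ks → totalCoeff (∏linSum {n} ks) ≡ product ks
totalCoeff-∏linSum []       []           = refl
totalCoeff-∏linSum {n} (k ∷ ks) (k≤n ∷ ks≤n) =
  trans (totalCoeff-⊗ (linSum k) (∏linSum {n} ks)) (cong₂ _*_ (totalCoeff-linSum k≤n) (totalCoeff-∏linSum ks ks≤n))

totalCoeff-p : ∀ n → totalCoeff (p n) ≡ n !
totalCoeff-p n = trans (totalCoeff-∏linSum (map suc (upTo n)) (map⁺ (all-upTo n))) (factorial-upTo n)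

countAbove : ℕ → List ℕ → ℕ
countAbove t ks = length (filter (t <?_) ks)

countAbove-++ : ∀ t ks ls → countAbove t (ks ++ ls) ≡ countAbove t ks + countAbove t ls
countAbove-++ t ks ls = trans (cong length (filter-++ (t <?_) ks ls)) (length-++ (filter (t <?_) ks))

countAbove-[k]-< : ∀ {t k} → t < k → countAbove t [ k ] ≡ 1
countAbove-[k]-< t<k = cong length (filter-accept (_ <?_) t<k)

countAbove-[k]-≥ : ∀ {t k} → k ≤ t → countAbove t [ k ] ≡ 0
countAbove-[k]-≥ k≤t = cong length (filter-reject (_ <?_) (≤⇒≯ k≤t))

countAbove-upTo : ∀ n t → countAbove t (map suc (upTo n)) ≡ n ∸ t
countAbove-upTo zero    t = sym (0∸n≡0 t)
countAbove-upTo (suc n) t = begin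
  countAbove t (map suc (upTo (suc n)))                     ≡⟨ cong (countAbove t) (map-suc-upTo-∷ʳ n) ⟩
  countAbove t (map suc (upTo n) ++ [ suc n ])              ≡⟨ countAbove-++ t (map suc (upTo n)) [ suc n ] ⟩
  countAbove t (map suc (upTo n)) + countAbove t [ suc n ]  ≡⟨ cong (_+ countAbove t [ suc n ]) (countAbove-upTo n t) ⟩
  n ∸ t + countAbove t [ suc n ]                            ≡⟨ last t ⟩
  suc n ∸ t                                                 ∎
  where
  last : ∀ t → n ∸ t + countAbove t [ suc n ] ≡ suc n ∸ t
  last t with t <? suc n
  ... | yes t<1+n@(s≤s t≤n) = begin
    n ∸ t + countAbove t [ suc n ]  ≡⟨ cong (n ∸ t +_) (countAbove-[k]-< t<1+n) ⟩
    n ∸ t + 1                       ≡⟨ +-comm (n ∸ t) 1 ⟩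
    suc (n ∸ t)                     ≡⟨ +-∸-assoc 1 t≤n ⟨
    suc n ∸ t                       ∎
  ... | no  t≮1+n = begin
    n ∸ t + countAbove t [ suc n ]  ≡⟨ cong (n ∸ t +_) (countAbove-[k]-≥ (≮⇒≥ t≮1+n)) ⟩
    n ∸ t + 0                       ≡⟨ +-identityʳ (n ∸ t) ⟩
    n ∸ t                           ≡⟨ m≤n⇒m∸n≡0 (≤-trans (n≤1+n n) (≮⇒≥ t≮1+n)) ⟩
    0                               ≡⟨ m≤n⇒m∸n≡0 (≮⇒≥ t≮1+n) ⟨
    suc n ∸ t                       ∎

-- Exponent vectors e of the monomials of ∏_{k ∈ ks} (x₁ + ⋯ + x_k): each factor contributes
-- one to the degree, and to x_{t+1}, x_{t+2}, … only if t < k.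
Admissible : ∀ {n} → List ℕ → Mono n → Set
Admissible ks e = vsum e ≡ length ks × (∀ t → sumFrom t e ≤ countAbove t ks)

unit-Admissible : ∀ {n k} (i : Fin n) → suc (toℕ i) ≤ k → Admissible [ k ] (unit i)
unit-Admissible {k = k} i i<k = vsum-unit i , bound
  where
  bound : ∀ t → sumFrom t (unit i) ≤ countAbove t [ k ]
  bound t with t <? k
  ... | yes t<k = subst (sumFrom t (unit i) ≤_) (trans (vsum-unit i) (sym (countAbove-[k]-< t<k))) (sumFrom≤vsum t (unit i))
  ... | no  t≮k = ≤-reflexive (trans (sumFrom-unit i (<-≤-trans i<k (≮⇒≥ t≮k)))
                                      (sym (countAbove-[k]-≥ (≮⇒≥ t≮k))))

linSum-Admissible : ∀ {n} k → AllExponents (Admissible [ k ]) (linSum {n} k)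
linSum-Admissible {n} k = concat⁺ (map⁺ (All.universal term-Admissible (allFin n)))
  where
  term-Admissible : ∀ i → AllExponents (Admissible [ k ]) (if ⌊ suc (toℕ i) ≤? k ⌋ then var i else [])
  term-Admissible i with suc (toℕ i) ≤? k
  ... | yes i<k = unit-Admissible i i<k ∷ []
  ... | no  _   = []

one-Admissible : ∀ {n} → AllExponents (Admissible []) (one {n})
one-Admissible {n} =
  (vsum-replicate-0 n , λ t → subst (sumFrom t (V.replicate n 0) ≤_) (vsum-replicate-0 n) (sumFrom≤vsum t _)) ∷ []

Admissible-zipWith : ∀ {n k ks} {e f : Mono n} →
                     Admissible [ k ] e → Admissible ks f → Admissible (k ∷ ks) (V.zipWith _+_ e f)
Admissible-zipWith {k = k} {ks} {e} {f} (sum-e , bound-e) (sum-f , bound-f) =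
  trans (sumFrom-zipWith 0 e f) (cong₂ _+_ sum-e sum-f) ,
  λ t → subst₂ _≤_ (sym (sumFrom-zipWith t e f)) (sym (countAbove-++ t [ k ] ks)) (+-mono-≤ (bound-e t) (bound-f t))

AllExponents-⊗ : ∀ {n} {P R S : Pred (Mono n) ℓ} → (∀ {e f} → P e → R f → S (V.zipWith _+_ e f)) →
                 ∀ {q r} → AllExponents P q → AllExponents R r → AllExponents S (q ⊗ r)
AllExponents-⊗ combine []          Rr = []
AllExponents-⊗ combine (Pe ∷ Pq)   Rr = ++⁺ (map⁺ (All.map (combine Pe) Rr)) (AllExponents-⊗ combine Pq Rr)

∏linSum-Admissible : ∀ {n} ks → AllExponents (Admissible ks) (∏linSum {n} ks)
∏linSum-Admissible []       = one-Admissible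
∏linSum-Admissible (k ∷ ks) = AllExponents-⊗ (Admissible-zipWith {k = k} {ks}) (linSum-Admissible k) (∏linSum-Admissible ks)

p-exponents : ∀ n → AllExponents (λ e → InA n e × VAll.All (_≤ n) e) (p n)
p-exponents n = All.map admissible⇒InA (∏linSum-Admissible (map suc (upTo n)))
  where
  admissible⇒InA : ∀ {e} → Admissible (map suc (upTo n)) e → InA n e × VAll.All (_≤ n) e
  admissible⇒InA {e} (sum≡ , bound) = InA-intro (λ {k} _ → subst (sumFrom k e ≤_) (countAbove-upTo n k) (bound k)) sum≡n
                                    , vsum≤⇒All≤ e (≤-reflexive sum≡n)
    where
    sum≡n : vsum e ≡ n
    sum≡n = trans sum≡ (trans (length-map suc (upTo n)) (length-upTo n))

sum-c≡n! : ∀ n → sum (map (c n) (𝒜 n)) ≡ n !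
sum-c≡n! n = trans (sum-coeff≡totalCoeff (p n) (𝒜 n) (All.map (λ (inA , e≤n) → length-filter-≟-𝒜 inA e≤n) (p-exponents n)))
                   (totalCoeff-p n)

corollary2 : (n : ℕ) →
    sum (map (c n) (𝒜 n)) * Catalan n ≡ (n !) * length (𝒜 n)
corollary2 n = begin
  sum (map (c n) (𝒜 n)) * Catalan n  ≡⟨ cong₂ _*_ (sum-c≡n! n) (Catalan≡ballot n) ⟩
  n ! * ballot n n                    ≡⟨ cong (n ! *_) (length-𝒜 n) ⟨
  n ! * length (𝒜 n)                  ∎
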